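{- Let $n\ge2$, let $\mathcal F_n(\hat q,\hat s)$ and $\mathcal F_n(q,s)$ be as in the context, and let $c$ be a positive integer. If $\mathcal F_n(\hat q,\hat s)\star c=\mathcal F_n(q,s)$, then either $c$ divides $\hat q$ or $c$ divides $\hat s$.
   Context: $\mathcal F_n=\{p/q:0\le p<q\le n,\ \gcd(p,q)=1\}$ is the set of Farey fractions of order $n$; a Farey pair $(p/q,r/s)$ of order $n$ consists of $p/q<r/s$ in $\mathcal F_n$ with no element of $\mathcal F_n$ strictly between them. For integers $q<s\le n$ with $\gcd(q,s)=1$ and $q+s>n$, there are exactly two Farey pairs of order $n$ with denominators $q$ and $s$: $\mathcal F_n(q,s)=\{(p/q,r/s),((s-r)/s,(q-p)/q)\}$ for uniquely determined integers $p,r$. Let $\mathcal F_n(\hat q,\hat s)=\{(\hat p/\hat q,\hat r/\hat s),((\hat s-\hat r)/\hat s,(\hat q-\hat p)/\hat q)\}$ with $\hat q<\hat s\le n$, $\gcd(\hat q,\hat s)=1$, $\hat q+\hat s>n$, and let $\{x\}:=x-\lfloor x\rfloor$. For $c\in\mathbb N$ we write $\mathcal F_n(\hat q,\hat s)\star c=\mathcal F_n(q,s)$ if both (a) $\{(\{c\hat p/\hat q\},\{c\hat r/\hat s\}),(\{c(\hat s-\hat r)/\hat s\},\{c(\hat q-\hat p)/\hat q\})\}=\mathcal F_n(q,s)$, and (b) $\lfloor c\hat p/\hat q\rfloor=\lfloor c\hat r/\hat s\rfloor$ and $\lfloor c(\hat q-\hat p)/\hat q\rfloor=\lfloor c(\hat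 s-\hat r)/\hat s\rfloor$. -}

module Defs where

open import Data.Nat as ℕ using (ℕ; zero; suc; _<_; _≤_)
open import Data.Nat.Coprimality using (Coprime)
open import Data.Integer as ℤ using (ℤ; +_)
open import Data.Rational as ℚ using (ℚ; floor; 0ℚ)
open import Data.Product using (_×_; _,_)
open import Data.Sum using (_⊎_)
open import Relation.Binary.PropositionalEquality using (_≡_)
open import Relation.Nullary using (¬_)

-- the rational number p/q (for q = 0 we return 0; only used with q ≥ 1)
frac : ℕ → ℕ → ℚ
frac p zero    = 0ℚ
frac p (suc k) = ℚ._/_ (+ p) (suc k)

fract : ℚ → ℚ
fract x = x ℚ.- (ℚ._/_ (floor x) 1)

InFarey : ℕ → ℕ → ℕ → Set
InFarey n p q = p < q × q ≤ n × Coprime p q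

FareyPair : ℕ → ℕ → ℕ → ℕ → ℕ → Set
FareyPair n p q r s =
  InFarey n p q × InFarey n r s × frac p q ℚ.< frac r s ×
  (∀ a b → InFarey n a b → ¬ (frac p q ℚ.< frac a b × frac a b ℚ.< frac r s))

AdmissibleDenoms : ℕ → ℕ → ℕ → Set
AdmissibleDenoms n q s = q < s × s ≤ n × Coprime q s × n < q ℕ.+ s

SetEq₂ : {A : Set} → A → A → A → A → Set
SetEq₂ x y u v = (x ≡ u × y ≡ v) ⊎ (x ≡ v × y ≡ u)

-- F_n(q̂,ŝ) ⋆ c = F_n(q,s), where F_n(q̂,ŝ) = {(p̂/q̂, r̂/ŝ), ((ŝ-r̂)/ŝ, (q̂-p̂)/q̂)}
-- and F_n(q,s) = {(p/q, r/s), ((s-r)/s, (q-p)/q)}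
Star : (q̂ ŝ p̂ r̂ c q s p r : ℕ) → Set
Star q̂ ŝ p̂ r̂ c q s p r =
  SetEq₂ {ℚ × ℚ}
    (fract (frac (c ℕ.* p̂) q̂) , fract (frac (c ℕ.* r̂) ŝ))
    (fract (frac (c ℕ.* (ŝ ℕ.∸ r̂)) ŝ) , fract (frac (c ℕ.* (q̂ ℕ.∸ p̂)) q̂))
    (frac p q , frac r s)
    (frac (s ℕ.∸ r) s , frac (q ℕ.∸ p) q)
  ×
  ( floor (frac (c ℕ.* p̂) q̂) ≡ floor (frac (c ℕ.* r̂) ŝ)
  × floor (frac (c ℕ.* (q̂ ℕ.∸ p̂)) q̂) ≡ floor (frac (c ℕ.* (ŝ ℕ.∸ r̂)) ŝ))

-- Farey neighbours p/q < r/s satisfy r q - p s = 1, and so does the reflected pair ((s-r)/s, (q-p)/q).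
-- Condition ⋆ says that c p̂/q̂ and c r̂/ŝ are one integer F plus the two fractions P/Q, R/S of one of
-- these pairs. Clearing denominators and using both determinants gives c Q S = q̂ ŝ, while P/Q and R/S
-- being in lowest terms gives Q ∣ q̂ and S ∣ ŝ. Hence c = (q̂/Q)(ŝ/S), and since q̂, ŝ ≤ n < Q + S,
-- one of the two cofactors is 1.
module Submission where

open import Defs
open import Data.Integer as ℤ using (ℤ; +_)
import Data.Integer.Properties as ℤ
import Data.Integer.Divisibility.Signed as ℤ
open import Data.List using ([]; _∷_)
open import Data.Nat using (ℕ; zero; suc; _≤_; _<_; NonZero; z<s)
open import Data.Nat.Coprimality as Coprimality using (Coprime; coprime-divisor; coprime-Bézout)
open import Data.Nat.Divisibility
  using (_∣_; divides; quotient; ∣-antisym; ∣1⇒≡1; ∣m+n∣m⇒∣n; ∣m∣n⇒∣m+n; n∣m*n; m∣m*n; ∣m⇒∣m*n; ∣n⇒∣m*n)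
open import Data.Nat.DivMod using (_%_; _/_; m≡m%n+[m/n]*n; m%n<n)
open import Data.Nat.GCD using (module Bézout)
open import Data.Product using (_×_; _,_; ∃-syntax; ∃₂)
open import Data.Product.Properties using (,-injective)
open import Data.Rational as ℚ using (floor)
import Data.Rational.Properties as ℚ
open import Data.Rational.Unnormalised as ℚᵘ using (mkℚᵘ; *<*; *≡*)
import Data.Rational.Unnormalised.Properties as ℚᵘ
open import Data.Sum using (_⊎_; inj₁; inj₂)
open import Relation.Binary.Definitions using (tri<; tri≈; tri>)
open import Relation.Binary.PropositionalEquality
open import Relation.Nullary using (contradiction)

module IntegerIdentities where
  open import Data.Integer using (_+_; _*_; _-_; -_; 1ℤ)
  open import Data.Integer.Tactic.RingSolver using (solve)
  open ≡-Reasoning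

  -- The hypothesis is m/K - F/1 = p/L cross-multiplied exactly as ℚᵘ computes it.
  m/K-F≡p/L⇒m*L≡[F*L+p]*K : ∀ (m F K L p : ℤ) →
    (m * 1ℤ + - F * K) * L ≡ p * (K * 1ℤ) → m * L ≡ (F * L + p) * K
  m/K-F≡p/L⇒m*L≡[F*L+p]*K m F K L p eq = begin
    m * L                                  ≡⟨ solve (m ∷ F ∷ K ∷ L ∷ []) ⟩
    (m * 1ℤ + - F * K) * L + F * L * K     ≡⟨ cong (_+ F * L * K) eq ⟩
    p * (K * 1ℤ) + F * L * K               ≡⟨ solve (F ∷ K ∷ L ∷ p ∷ []) ⟩
    (F * L + p) * K                        ∎

  a*Q≡[F*Q+P]*b⇒P*b≡[a-F*b]*Q : ∀ (a b P Q F : ℤ) → a * Q ≡ (F * Q + P) * b → P * b ≡ (a - F * b) * Q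
  a*Q≡[F*Q+P]*b⇒P*b≡[a-F*b]*Q a b P Q F aQ≡[FQ+P]b = begin
    P * b                       ≡⟨ solve (b ∷ P ∷ Q ∷ F ∷ []) ⟩
    (F * Q + P) * b - F * Q * b ≡⟨ cong (_- F * Q * b) aQ≡[FQ+P]b ⟨
    a * Q - F * Q * b           ≡⟨ solve (a ∷ b ∷ Q ∷ F ∷ []) ⟩
    (a - F * b) * Q             ∎

  unimodular-shift⇒c*[Q*S]≡q̂*ŝ : ∀ (c p̂ q̂ r̂ ŝ P Q R S F : ℤ) →
    r̂ * q̂ ≡ p̂ * ŝ + 1ℤ → R * Q ≡ P * S + 1ℤ →
    c * p̂ * Q ≡ (F * Q + P) * q̂ → c * r̂ * S ≡ (F * S + R) * ŝ →
    c * (Q * S) ≡ q̂ * ŝ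
  unimodular-shift⇒c*[Q*S]≡q̂*ŝ c p̂ q̂ r̂ ŝ P Q R S F r̂q̂≡p̂ŝ+1 RQ≡PS+1 E₁ E₂ = begin
    c * (Q * S)                                         ≡⟨ solve (c ∷ p̂ ∷ ŝ ∷ Q ∷ S ∷ []) ⟩
    c * Q * S * (p̂ * ŝ + 1ℤ) - c * p̂ * Q * (S * ŝ)      ≡⟨ cong (λ z → c * Q * S * z - c * p̂ * Q * (S * ŝ)) r̂q̂≡p̂ŝ+1 ⟨
    c * Q * S * (r̂ * q̂) - c * p̂ * Q * (S * ŝ)           ≡⟨ solve (c ∷ p̂ ∷ q̂ ∷ r̂ ∷ ŝ ∷ Q ∷ S ∷ []) ⟩
    c * r̂ * S * (Q * q̂) - c * p̂ * Q * (S * ŝ)           ≡⟨ cong₂ (λ u v → u * (Q * q̂) - v * (S * ŝ)) E₂ E₁ ⟩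
    (F * S + R) * ŝ * (Q * q̂) - (F * Q + P) * q̂ * (S * ŝ) ≡⟨ solve (q̂ ∷ ŝ ∷ P ∷ Q ∷ R ∷ S ∷ F ∷ []) ⟩
    q̂ * ŝ * (R * Q) - q̂ * ŝ * (P * S)                   ≡⟨ cong (λ z → q̂ * ŝ * z - q̂ * ŝ * (P * S)) RQ≡PS+1 ⟩
    q̂ * ŝ * (P * S + 1ℤ) - q̂ * ŝ * (P * S)              ≡⟨ solve (q̂ ∷ ŝ ∷ P ∷ S ∷ []) ⟩
    q̂ * ŝ                                               ∎

open IntegerIdentities
open import Data.Nat using (_+_; _*_; _∸_)
open import Data.Nat.Properties
open import Data.Nat.Tactic.RingSolver using (solve; solve-∀)

toℚᵘ-frac : ∀ a k → ℚ.toℚᵘ (frac a (suc k)) ℚᵘ.≃ mkℚᵘ (+ a) k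
toℚᵘ-frac a k = ℚ.toℚᵘ-fromℚᵘ (mkℚᵘ (+ a) k)

frac-<⇒*< : ∀ a k b l → frac a (suc k) ℚ.< frac b (suc l) → a * suc l < b * suc k
frac-<⇒*< a k b l a/k<b/l
  with ℚᵘ.<-respˡ-≃ (toℚᵘ-frac a k) (ℚᵘ.<-respʳ-≃ (toℚᵘ-frac b l) (ℚ.toℚᵘ-mono-< a/k<b/l))
... | *<* a*l<b*k = ℤ.drop‿+<+ (subst₂ ℤ._<_ (sym (ℤ.pos-* a (suc l))) (sym (ℤ.pos-* b (suc k))) a*l<b*k)

*<⇒frac-< : ∀ a k b l → a * suc l < b * suc k → frac a (suc k) ℚ.< frac b (suc l)
*<⇒frac-< a k b l a*l<b*k = ℚ.toℚᵘ-cancel-<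
  (ℚᵘ.<-respˡ-≃ (ℚᵘ.≃-sym (toℚᵘ-frac a k)) (ℚᵘ.<-respʳ-≃ (ℚᵘ.≃-sym (toℚᵘ-frac b l))
    (*<* (subst₂ ℤ._<_ (ℤ.pos-* a (suc l)) (ℤ.pos-* b (suc k)) (ℤ.+<+ a*l<b*k)))))

toℚᵘ-fract-frac : ∀ m k →
  ℚ.toℚᵘ (fract (frac m (suc k))) ℚᵘ.≃ mkℚᵘ (+ m) k ℚᵘ.- mkℚᵘ (floor (frac m (suc k))) 0
toℚᵘ-fract-frac m k = ℚᵘ.≃-trans (ℚ.toℚᵘ-homo-+ x (ℚ.- (F ℚ./ 1)))
  (ℚᵘ.+-cong (toℚᵘ-frac m k)
    (ℚᵘ.≃-trans (ℚ.toℚᵘ-homo‿- (F ℚ./ 1)) (ℚᵘ.-‿cong (ℚ.toℚᵘ-fromℚᵘ (mkℚᵘ F 0)))))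
  where
  x : ℚ.ℚ
  x = frac m (suc k)
  F : ℤ
  F = floor x

fract-frac≡⇒ : ∀ m k p l → fract (frac m (suc k)) ≡ frac p (suc l) →
  + m ℤ.* + suc l ≡ (floor (frac m (suc k)) ℤ.* + suc l ℤ.+ + p) ℤ.* + suc k
fract-frac≡⇒ m k p l eq
  with ℚᵘ.≃-trans (ℚᵘ.≃-sym (toℚᵘ-fract-frac m k))
                  (subst (λ x → ℚ.toℚᵘ x ℚᵘ.≃ mkℚᵘ (+ p) l) (sym eq) (toℚᵘ-frac p l))
... | *≡* eq′ = m/K-F≡p/L⇒m*L≡[F*L+p]*K (+ m) (floor (frac m (suc k))) (+ suc k) (+ suc l) (+ p) eq′

unimodular⇒coprime : ∀ p q {x y} → x * q ≡ p * y + 1 → Coprime x y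
unimodular⇒coprime p q eq {d} (d∣x , d∣y) =
  ∣1⇒≡1 (∣m+n∣m⇒∣n (subst (d ∣_) eq (∣m⇒∣m*n q d∣x)) (∣n⇒∣m*n p d∣y))

coprime⇒∃∣*+1 : ∀ {p q} → Coprime p (suc q) → ∃[ y ] suc q ∣ p * y + 1
coprime⇒∃∣*+1 {p} {q} p⊥q with coprime-Bézout p⊥q
... | Bézout.+- x y 1+y[1+q]≡xp = q * x , divides (1 + q * y) (begin
  p * (q * x) + 1         ≡⟨ solve (p ∷ q ∷ x ∷ []) ⟩
  q * (x * p) + 1         ≡⟨ cong (λ z → q * z + 1) 1+y[1+q]≡xp ⟨
  q * (1 + y * suc q) + 1 ≡⟨ solve (q ∷ y ∷ []) ⟩
  (1 + q * y) * suc q     ∎)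
  where open ≡-Reasoning
... | Bézout.-+ x y 1+xp≡y[1+q] =
  x , divides y (trans (+-comm (p * x) 1) (subst (λ z → 1 + z ≡ y * suc q) (*-comm x p) 1+xp≡y[1+q]))

p*[a+t*q]+1≡p*t*q+[p*a+1] : ∀ p a t q → p * (a + t * q) + 1 ≡ p * t * q + (p * a + 1)
p*[a+t*q]+1≡p*t*q+[p*a+1] = solve-∀

∣*+1-shift : ∀ {q} p a t → q ∣ p * a + 1 → q ∣ p * (a + t * q) + 1
∣*+1-shift {q} p a t q∣pa+1 =
  subst (q ∣_) (sym (p*[a+t*q]+1≡p*t*q+[p*a+1] p a t q)) (∣m∣n⇒∣m+n (n∣m*n (p * t)) q∣pa+1)

∣*+1-unshift : ∀ {q} p a t → q ∣ p * (a + t * q) + 1 → q ∣ p * a + 1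
∣*+1-unshift {q} p a t q∣ = ∣m+n∣m⇒∣n (subst (q ∣_) (p*[a+t*q]+1≡p*t*q+[p*a+1] p a t q) q∣) (n∣m*n (p * t))

∃-shift-into-window : ∀ n a q .{{_ : NonZero q}} → a ≤ n → ∃[ t ] (a + t * q ≤ n × n < q + (a + t * q))
∃-shift-into-window n a q a≤n = t , subst (y ≤_) y+r≡n (m≤m+n y r) , subst (_< q + y) y+r≡n y+r<q+y
  where
  t r y : ℕ
  t = (n ∸ a) / q
  r = (n ∸ a) % q
  y = a + t * q
  y+r≡n : y + r ≡ n
  y+r≡n = begin
    a + t * q + r   ≡⟨ +-assoc a (t * q) r ⟩
    a + (t * q + r) ≡⟨ cong (_+_ a) (+-comm (t * q) r) ⟩
    a + (r + t * q) ≡⟨ cong (_+_ a) (m≡m%n+[m/n]*n (n ∸ a) q) ⟨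
    a + (n ∸ a)     ≡⟨ m+[n∸m]≡n a≤n ⟩
    n               ∎
    where open ≡-Reasoning
  y+r<q+y : y + r < q + y
  y+r<q+y = subst (y + r <_) (+-comm y q) (+-monoʳ-< y (m%n<n (n ∸ a) q))

∃-unimodular-in-window : ∀ {n p q} → Coprime p (suc q) → suc q ≤ n →
  ∃₂ λ x y → x * suc q ≡ p * y + 1 × y ≤ n × n < suc q + y
∃-unimodular-in-window {n} {p} {q} p⊥q q≤n with coprime⇒∃∣*+1 p⊥q
... | y₀ , q∣py₀+1 with ∃-shift-into-window n (y₀ % suc q) (suc q) (≤-trans (<⇒≤ (m%n<n y₀ (suc q))) q≤n)
...   | t , y≤n , n<q+y = quotient q∣py+1 , y , sym (_∣_.equality q∣py+1) , y≤n , n<q+y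
  where
  y : ℕ
  y = y₀ % suc q + t * suc q
  q∣py+1 : suc q ∣ p * y + 1
  q∣py+1 = ∣*+1-shift p _ t (∣*+1-unshift p _ (y₀ / suc q)
    (subst (λ z → suc q ∣ p * z + 1) (m≡m%n+[m/n]*n y₀ (suc q)) q∣py₀+1))

unimodular-between⇒+≤ : ∀ p q r s x y → x * q ≡ p * y + 1 → p * s < r * q → r * y < x * s → q + y ≤ s
unimodular-between⇒+≤ p q r s x y xq≡py+1 ps<rq ry<xs =
  +-cancelʳ-≤ (q * (r * y) + y * (p * s)) (q + y) s (begin
    q + y + (q * (r * y) + y * (p * s)) ≡⟨ solve (q ∷ y ∷ r ∷ p ∷ s ∷ []) ⟩
    q * suc (r * y) + y * suc (p * s)   ≤⟨ +-mono-≤ (*-monoʳ-≤ q ry<xs) (*-monoʳ-≤ y ps<rq) ⟩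
    q * (x * s) + y * (r * q)           ≡⟨ solve (q ∷ x ∷ s ∷ y ∷ r ∷ []) ⟩
    s * (x * q) + y * (r * q)           ≡⟨ cong (λ z → s * z + y * (r * q)) xq≡py+1 ⟩
    s * (p * y + 1) + y * (r * q)       ≡⟨ solve (s ∷ p ∷ y ∷ r ∷ q ∷ []) ⟩
    s + (q * (r * y) + y * (p * s))     ∎)
  where open ≤-Reasoning

coprime-*≡*⇒≡ : ∀ {x y r s} → Coprime x y → Coprime r s → r * y ≡ x * s → y ≡ s
coprime-*≡*⇒≡ {x} {r = r} x⊥y r⊥s ry≡xs = ∣-antisym
  (coprime-divisor (Coprimality.sym x⊥y) (divides r (sym ry≡xs)))
  (coprime-divisor (Coprimality.sym r⊥s) (divides x ry≡xs))

-- The partner x/y of p/q with x q - p y = 1 and n - q < y ≤ n must be r/s: if r/s < x/y then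
-- s ≥ q + y > n, and if x/y < r/s then x/y lies strictly between p/q and r/s.
farey-pair-det : ∀ {n p q r s} → FareyPair n p q r s → r * q ≡ p * s + 1
farey-pair-det {n} {p} {suc q-1} {r} {suc s-1} ((_ , q≤n , p⊥q) , (r<s , s≤n , r⊥s) , p/q<r/s , adjacent) =
  compare-with (∃-unimodular-in-window p⊥q q≤n)
  where
  q s : ℕ
  q = suc q-1
  s = suc s-1
  compare-with : ∃₂ (λ x y → x * q ≡ p * y + 1 × y ≤ n × n < q + y) → r * q ≡ p * s + 1
  compare-with (x , zero , _ , _ , n<q+0) = contradiction (subst (_≤ n) (sym (+-identityʳ q)) q≤n) (<⇒≱ n<q+0)
  compare-with (x , y@(suc y-1) , xq≡py+1 , y≤n , n<q+y) with <-cmp (r * y) (x * s)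
  ... | tri< ry<xs _ _ =
    contradiction (≤-trans (unimodular-between⇒+≤ p q r s x y xq≡py+1 (frac-<⇒*< p q-1 r s-1 p/q<r/s) ry<xs) s≤n)
                  (<⇒≱ n<q+y)
  ... | tri≈ _ ry≡xs _ = begin
    r * q     ≡⟨ cong (_* q) r≡x ⟩
    x * q     ≡⟨ xq≡py+1 ⟩
    p * y + 1 ≡⟨ cong (λ z → p * z + 1) y≡s ⟩
    p * s + 1 ∎
    where
    open ≡-Reasoning
    y≡s : y ≡ s
    y≡s = coprime-*≡*⇒≡ {x} (unimodular⇒coprime p q xq≡py+1) r⊥s ry≡xs
    r≡x : r ≡ x
    r≡x = *-cancelʳ-≡ r x y (trans ry≡xs (cong (x *_) (sym y≡s)))
  ... | tri> _ _ xs<ry = contradiction (p/q<x/y , x/y<r/s) (adjacent x y (x<y , y≤n , unimodular⇒coprime p q xq≡py+1))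
    where
    x<y : x < y
    x<y = *-cancelʳ-< s x y (<-≤-trans xs<ry (≤-trans (*-monoˡ-≤ y (<⇒≤ r<s)) (≤-reflexive (*-comm s y))))
    p/q<x/y : frac p q ℚ.< frac x y
    p/q<x/y = *<⇒frac-< p q-1 x y-1 (subst (p * y <_) (sym xq≡py+1) (m<m+n (p * y) z<s))
    x/y<r/s : frac x y ℚ.< frac r s
    x/y<r/s = *<⇒frac-< x y-1 r s-1 xs<ry

unimodular-∸ : ∀ {p q r s} → p ≤ q → r ≤ s → r * q ≡ p * s + 1 → (q ∸ p) * s ≡ (s ∸ r) * q + 1
unimodular-∸ {p} {q} {r} {s} p≤q r≤s rq≡ps+1 = +-cancelʳ-≡ (p * s) _ _ (begin
  (q ∸ p) * s + p * s       ≡⟨ *-distribʳ-+ s (q ∸ p) p ⟨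
  (q ∸ p + p) * s           ≡⟨ cong (_* s) (m∸n+n≡m p≤q) ⟩
  q * s                     ≡⟨ *-comm q s ⟩
  s * q                     ≡⟨ cong (_* q) (m∸n+n≡m r≤s) ⟨
  (s ∸ r + r) * q           ≡⟨ *-distribʳ-+ q (s ∸ r) r ⟩
  (s ∸ r) * q + r * q       ≡⟨ cong (_+_ ((s ∸ r) * q)) rq≡ps+1 ⟩
  (s ∸ r) * q + (p * s + 1) ≡⟨ cong (_+_ ((s ∸ r) * q)) (+-comm (p * s) 1) ⟩
  (s ∸ r) * q + (1 + p * s) ≡⟨ +-assoc ((s ∸ r) * q) 1 (p * s) ⟨
  (s ∸ r) * q + 1 + p * s   ∎)
  where open ≡-Reasoning

coprime-∸ : ∀ {r s} → r ≤ s → Coprime r s → Coprime (s ∸ r) s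
coprime-∸ r≤s r⊥s {d} (d∣s∸r , d∣s) =
  r⊥s (∣m+n∣m⇒∣n (subst (d ∣_) (sym (m∸n+n≡m r≤s)) d∣s) d∣s∸r , d∣s)

unimodular-ℤ : ∀ p q r s → r * q ≡ p * s + 1 → + r ℤ.* + q ≡ + p ℤ.* + s ℤ.+ ℤ.1ℤ
unimodular-ℤ p q r s rq≡ps+1 = begin
  + r ℤ.* + q         ≡⟨ ℤ.pos-* r q ⟨
  + (r * q)           ≡⟨ cong +_ rq≡ps+1 ⟩
  + (p * s + 1)       ≡⟨ ℤ.pos-+ (p * s) 1 ⟩
  + (p * s) ℤ.+ ℤ.1ℤ   ≡⟨ cong (ℤ._+ ℤ.1ℤ) (ℤ.pos-* p s) ⟩
  + p ℤ.* + s ℤ.+ ℤ.1ℤ ∎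
  where open ≡-Reasoning

a*Q≡[F*Q+P]*b⇒Q∣b : ∀ {a b P Q} (F : ℤ) → + a ℤ.* + Q ≡ (F ℤ.* + Q ℤ.+ + P) ℤ.* + b → Coprime P Q → Q ∣ b
a*Q≡[F*Q+P]*b⇒Q∣b {a} {b} {P} {Q} F aQ≡[FQ+P]b P⊥Q = coprime-divisor (Coprimality.sym P⊥Q)
  (ℤ.∣⇒∣ᵤ (ℤ.divides (+ a ℤ.- F ℤ.* + b)
    (trans (ℤ.pos-* P b) (a*Q≡[F*Q+P]*b⇒P*b≡[a-F*b]*Q (+ a) (+ b) (+ P) (+ Q) F aQ≡[FQ+P]b))))

2*Q+2*S≡[Q+S]+[Q+S] : ∀ Q S → 2 * Q + 2 * S ≡ (Q + S) + (Q + S)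
2*Q+2*S≡[Q+S]+[Q+S] = solve-∀

c*[Q*S]≡q̂*ŝ⇒∣⊎∣ : ∀ {n c q̂ ŝ} Q S .{{_ : NonZero Q}} .{{_ : NonZero S}} →
  c * (Q * S) ≡ q̂ * ŝ → Q ∣ q̂ → S ∣ ŝ → 0 < q̂ → 0 < ŝ → q̂ ≤ n → ŝ ≤ n → n < Q + S →
  c ∣ q̂ ⊎ c ∣ ŝ
c*[Q*S]≡q̂*ŝ⇒∣⊎∣ {n} {c} Q S cQS≡q̂ŝ (divides g refl) (divides h refl) 0<gQ 0<hS gQ≤n hS≤n n<Q+S =
  cofactors g h c≡gh 0<gQ 0<hS gQ≤n hS≤n
  where
  c≡gh : c ≡ g * h
  c≡gh = *-cancelʳ-≡ c (g * h) (Q * S) {{m*n≢0 Q S}} (trans cQS≡q̂ŝ (solve (g ∷ Q ∷ h ∷ S ∷ [])))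
  cofactors : ∀ g h → c ≡ g * h → 0 < g * Q → 0 < h * S → g * Q ≤ n → h * S ≤ n → c ∣ g * Q ⊎ c ∣ h * S
  cofactors zero h _ () _ _ _
  cofactors g zero _ _ () _ _
  cofactors 1 h c≡h _ _ _ _ = inj₂ (subst (_∣ h * S) (sym (trans c≡h (+-identityʳ h))) (m∣m*n S))
  cofactors g 1 c≡g _ _ _ _ = inj₁ (subst (_∣ g * Q) (sym (trans c≡g (*-identityʳ g))) (m∣m*n Q))
  cofactors (suc (suc g)) (suc (suc h)) _ _ _ gQ≤n hS≤n = contradiction (+-mono-< n<Q+S n<Q+S) (≤⇒≯ (begin
    (Q + S) + (Q + S) ≡⟨ 2*Q+2*S≡[Q+S]+[Q+S] Q S ⟨
    2 * Q + 2 * S     ≤⟨ +-mono-≤ (*-monoˡ-≤ Q (m≤m+n 2 g)) (*-monoˡ-≤ S (m≤m+n 2 h)) ⟩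
    suc (suc g) * Q + suc (suc h) * S ≤⟨ +-mono-≤ gQ≤n hS≤n ⟩
    n + n             ∎))
    where open ≤-Reasoning

fract-pairs⇒∣⊎∣ : ∀ {n c p̂ q̂-1 r̂ ŝ-1 P Q-1 R S-1} →
  r̂ * suc q̂-1 ≡ p̂ * suc ŝ-1 + 1 → R * suc Q-1 ≡ P * suc S-1 + 1 → Coprime P (suc Q-1) → Coprime R (suc S-1) →
  fract (frac (c * p̂) (suc q̂-1)) ≡ frac P (suc Q-1) → fract (frac (c * r̂) (suc ŝ-1)) ≡ frac R (suc S-1) →
  floor (frac (c * p̂) (suc q̂-1)) ≡ floor (frac (c * r̂) (suc ŝ-1)) →
  suc q̂-1 ≤ n → suc ŝ-1 ≤ n → n < suc Q-1 + suc S-1 → c ∣ suc q̂-1 ⊎ c ∣ suc ŝ-1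
fract-pairs⇒∣⊎∣ {_} {c} {p̂} {q̂-1} {r̂} {ŝ-1} {P} {Q-1} {R} {S-1}
  r̂q̂≡p̂ŝ+1 RQ≡PS+1 P⊥Q R⊥S fract₁ fract₂ floor≡ q̂≤n ŝ≤n n<Q+S =
  c*[Q*S]≡q̂*ŝ⇒∣⊎∣ Q S cQS≡q̂ŝ
    (a*Q≡[F*Q+P]*b⇒Q∣b {c * p̂} F E₁ P⊥Q) (a*Q≡[F*Q+P]*b⇒Q∣b {c * r̂} F E₂ R⊥S)
    z<s z<s q̂≤n ŝ≤n n<Q+S
  where
  q̂ ŝ Q S : ℕ
  q̂ = suc q̂-1
  ŝ = suc ŝ-1
  Q = suc Q-1
  S = suc S-1
  F : ℤ
  F = floor (frac (c * p̂) q̂)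
  E₁ : + (c * p̂) ℤ.* + Q ≡ (F ℤ.* + Q ℤ.+ + P) ℤ.* + q̂
  E₁ = fract-frac≡⇒ (c * p̂) q̂-1 P Q-1 fract₁
  E₂ : + (c * r̂) ℤ.* + S ≡ (F ℤ.* + S ℤ.+ + R) ℤ.* + ŝ
  E₂ = subst (λ G → + (c * r̂) ℤ.* + S ≡ (G ℤ.* + S ℤ.+ + R) ℤ.* + ŝ) (sym floor≡)
         (fract-frac≡⇒ (c * r̂) ŝ-1 R S-1 fract₂)
  cQS≡q̂ŝ : c * (Q * S) ≡ q̂ * ŝ
  cQS≡q̂ŝ = ℤ.+-injective (begin
    + (c * (Q * S))           ≡⟨ ℤ.pos-* c (Q * S) ⟩
    + c ℤ.* + (Q * S)         ≡⟨ cong (+ c ℤ.*_) (ℤ.pos-* Q S) ⟩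
    + c ℤ.* (+ Q ℤ.* + S)     ≡⟨ unimodular-shift⇒c*[Q*S]≡q̂*ŝ (+ c) (+ p̂) (+ q̂) (+ r̂) (+ ŝ) (+ P) (+ Q) (+ R) (+ S) F
                                   (unimodular-ℤ p̂ q̂ r̂ ŝ r̂q̂≡p̂ŝ+1) (unimodular-ℤ P Q R S RQ≡PS+1)
                                   (trans (cong (ℤ._* + Q) (sym (ℤ.pos-* c p̂))) E₁)
                                   (trans (cong (ℤ._* + S) (sym (ℤ.pos-* c r̂))) E₂) ⟩
    + q̂ ℤ.* + ŝ               ≡⟨ ℤ.pos-* q̂ ŝ ⟨
    + (q̂ * ŝ)                 ∎)
    where open ≡-Reasoning

lemma3p3 : (n q̂ ŝ p̂ r̂ q s p r c : ℕ) →
    2 ≤ n →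
    AdmissibleDenoms n q̂ ŝ → FareyPair n p̂ q̂ r̂ ŝ →
    AdmissibleDenoms n q s → FareyPair n p q r s →
    1 ≤ c →
    Star q̂ ŝ p̂ r̂ c q s p r →
    c ∣ q̂ ⊎ c ∣ ŝ
lemma3p3 n (suc q̂-1) (suc ŝ-1) p̂ r̂ (suc q-1) (suc s-1) p r c _ _ fareŷ@((_ , q̂≤n , _) , (_ , ŝ≤n , _) , _)
  (_ , _ , _ , n<q+s) farey@((_ , _ , p⊥q) , (_ , _ , r⊥s) , _) _ (inj₁ (pairs≡ , _) , floor≡ , _) =
  let (fract₁ , fract₂) = ,-injective pairs≡ in
  fract-pairs⇒∣⊎∣ (farey-pair-det fareŷ) (farey-pair-det farey) p⊥q r⊥s
    fract₁ fract₂ floor≡ q̂≤n ŝ≤n n<q+s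
lemma3p3 n (suc q̂-1) (suc ŝ-1) p̂ r̂ (suc q-1) (suc s-1) p r c _ _ fareŷ@((_ , q̂≤n , _) , (_ , ŝ≤n , _) , _)
  (_ , _ , _ , n<q+s) farey@((p<q , _ , p⊥q) , (r<s , _ , r⊥s) , _) _ (inj₂ (pairs≡ , _) , floor≡ , _) =
  let (fract₁ , fract₂) = ,-injective pairs≡ in
  fract-pairs⇒∣⊎∣ (farey-pair-det fareŷ) (unimodular-∸ (<⇒≤ p<q) (<⇒≤ r<s) (farey-pair-det farey))
    (coprime-∸ (<⇒≤ r<s) r⊥s) (coprime-∸ (<⇒≤ p<q) p⊥q) fract₁ fract₂ floor≡ q̂≤n ŝ≤n
    (subst (n <_) (+-comm (suc q-1) (suc s-1)) n<q+s)
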